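{- If $A_1-A_2-\cdots-A_m-A_1$ is an induced cyclic sequence in a graph $G$ with $m\ge 3$, then $G$ contains an induced cycle with at least $m$ vertices.
   Context: For pairwise disjoint vertex sets $A_1,\dots,A_m$ of $G$, the sequence $A_1-\cdots-A_m-A_1$ is an induced cyclic sequence if each $G[A_i]$ is connected, there is an edge between $A_i$ and $A_{i+1}$ for every $i\in\{1,\dots,m-1\}$ (and between $A_m$ and $A_1$), and there is no edge between $A_i$ and $A_j$ whenever $|j-i|\not\equiv 0,\pm1 \pmod m$. -}

module Defs where

open import Level using (0ℓ)
open import Data.Nat using (ℕ; zero; suc; _≤_)
open import Data.Fin using (Fin; toℕ)
open import Data.Product using (_×_; Σ)
open import Data.Sum using (_⊎_)
open import Data.Empty using (⊥)
open import Relation.Nullary using (¬_; Dec)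
open import Relation.Binary.PropositionalEquality using (_≡_)
open import Function.Definitions using (Injective)
open import Function.Bundles using (_⇔_)

record Graph (n : ℕ) : Set₁ where
  field
    Adj    : Fin n → Fin n → Set
    adj?   : ∀ u v → Dec (Adj u v)
    sym    : ∀ {u v} → Adj u v → Adj v u
    irrefl : ∀ {u} → ¬ Adj u u
open Graph public

record VSet (n : ℕ) : Set₁ where
  field
    _∋_ : Fin n → Set
    mem? : ∀ v → Dec (_∋_ v)
open VSet public

data WalkIn {n : ℕ} (G : Graph n) (S : VSet n) : Fin n → Fin n → Set where
  here : ∀ {u} → (S ∋ u) → WalkIn G S u u
  step : ∀ {u w v} → (S ∋ u) → Adj G u w → WalkIn G S w v → WalkIn G S u v

Connected : ∀ {n} → Graph n → VSet n → Set
Connected G S =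
  Σ (Fin _) (λ v → S ∋ v) × (∀ u v → S ∋ u → S ∋ v → WalkIn G S u v)

EdgeBetween : ∀ {n} → Graph n → VSet n → VSet n → Set
EdgeBetween G S T = Σ (Fin _) λ u → Σ (Fin _) λ v → (S ∋ u) × (T ∋ v) × Adj G u v

Disjoint : ∀ {n} → VSet n → VSet n → Set
Disjoint S T = ∀ v → S ∋ v → T ∋ v → ⊥

Next : (m : ℕ) → Fin m → Fin m → Set
Next m i j = (suc (toℕ i) ≡ toℕ j) ⊎ ((suc (toℕ i) ≡ m) × (toℕ j ≡ 0))

CycAdj : (m : ℕ) → Fin m → Fin m → Set
CycAdj m i j = Next m i j ⊎ Next m j i

record InducedCyclicSeq {n : ℕ} (G : Graph n) (m : ℕ) (A : Fin m → VSet n) : Set where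
  field
    disjoint    : ∀ i j → ¬ (i ≡ j) → Disjoint (A i) (A j)
    connected   : ∀ i → Connected G (A i)
    consecutive : ∀ i j → Next m i j → EdgeBetween G (A i) (A j)
    nonconsec   : ∀ i j → ¬ (i ≡ j) → ¬ CycAdj m i j → ¬ EdgeBetween G (A i) (A j)

record InducedCycle {n : ℕ} (G : Graph n) (k : ℕ) (v : Fin k → Fin n) : Set where
  field
    length≥3 : 3 ≤ k
    distinct : Injective _≡_ _≡_ v
    adj⇔     : ∀ i j → Adj G (v i) (v j) ⇔ CycAdj k i j

module Submission where

-- Let Rest be the union of A₁, …, A₍ₘ₋₁₎. The edges between consecutive parts give a walk in
-- G[Rest] from a vertex of A₁ with a neighbour in A₀ to such a vertex of A₍ₘ₋₁₎; from it one
-- extracts an induced path P meeting these two sets only at its ends. A step along P raises the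
-- index of the part A_j by at most one, so P has at least m - 1 vertices, and no inner vertex of
-- P has a neighbour in A₀. An induced path Q of G[A₀] from a neighbour of the last vertex of P
-- to a neighbour of its first vertex, meeting these neighbourhoods only at its ends, closes P
-- into an induced cycle with at least m vertices.

open import Level using (0ℓ)
open import Data.Nat using (ℕ; zero; suc; _+_; _∸_; _≤_; _<_; z≤n; s≤s; z<s; _≤?_)
open import Data.Nat.Properties
open import Data.Fin using (Fin; toℕ; fromℕ<) renaming (zero to fzero; suc to fsuc)
import Data.Fin.Properties as Fin
open import Data.Product using (Σ; ∃; _×_; _,_; proj₁; proj₂)
open import Data.Sum as Sum using (_⊎_; inj₁; inj₂)
open import Function using (_∘_; mk⇔)
open import Relation.Nullary using (¬_; yes; no; contradiction)
open import Relation.Nullary.Decidable using (¬?; _×-dec_; _⊎-dec_)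
open import Relation.Unary using (Pred; Decidable)
open import Relation.Binary using (tri<; tri≈; tri>)
open import Relation.Binary.PropositionalEquality as ≡ using (_≡_; _≢_; refl; cong; subst; subst₂)

open import Defs

least : {P : Pred ℕ 0ℓ} → Decidable P → ∀ {N} → P N →
        ∃ λ i → i ≤ N × P i × (∀ {j} → j < i → ¬ P j)
least P? {zero} pN = 0 , z≤n , pN , λ ()
least {P} P? {suc N} pN with P? 0
... | yes p0 = 0 , z≤n , p0 , λ ()
... | no ¬p0 with least {P ∘ suc} (P? ∘ suc) pN
...   | i , i≤N , pi , below =
  suc i , s≤s i≤N , pi , λ { {zero} _ → ¬p0 ; {suc j} j<i → below (≤-pred j<i) }

Nextℕ : ℕ → ℕ → ℕ → Set
Nextℕ k i j = suc i ≡ j ⊎ (suc i ≡ k × j ≡ 0)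

CycAdjℕ : ℕ → ℕ → ℕ → Set
CycAdjℕ k i j = Nextℕ k i j ⊎ Nextℕ k j i

≤-suc-cases : ∀ {i n} → i ≤ suc n → i ≤ n ⊎ i ≡ suc n
≤-suc-cases = Sum.map₁ ≤-pred ∘ m≤n⇒m<n∨m≡n

module Paths {n : ℕ} (G : Graph n) where

  walk-start : ∀ {S u v} → WalkIn G S u v → S ∋ u
  walk-start (here su) = su
  walk-start (step su _ _) = su

  _++ʷ_ : ∀ {S u v w} → WalkIn G S u v → WalkIn G S v w → WalkIn G S u w
  here _ ++ʷ walk = walk
  step su uw walk₁ ++ʷ walk₂ = step su uw (walk₁ ++ʷ walk₂)

  walk-mono : ∀ {S T u v} → (∀ {w} → S ∋ w → T ∋ w) → WalkIn G S u v → WalkIn G T u v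
  walk-mono S⊆T (here su) = here (S⊆T su)
  walk-mono S⊆T (step su uw walk) = step (S⊆T su) uw (walk-mono S⊆T walk)

  -- The path is vertex 0, …, vertex len; the values of vertex beyond len are junk.
  record InducedPath (S : VSet n) (X Y : Pred (Fin n) 0ℓ) : Set where
    field
      len             : ℕ
      vertex          : ℕ → Fin n
      inside          : ∀ {i} → i ≤ len → S ∋ vertex i
      starts          : X (vertex 0)
      ends            : Y (vertex len)
      edge            : ∀ {i} → i < len → Adj G (vertex i) (vertex (suc i))
      chordless       : ∀ {i j} → suc i < j → j ≤ len → ¬ Adj G (vertex i) (vertex j)
      distinct        : ∀ {i j} → i < j → j ≤ len → vertex i ≢ vertex j
      X-only-at-start : ∀ {i} → 0 < i → i ≤ len → ¬ X (vertex i)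
      Y-only-at-end   : ∀ {i} → i < len → ¬ Y (vertex i)

  module _ {S : VSet n} {X Y : Pred (Fin n) 0ℓ} (P : InducedPath S X Y) where
    open InducedPath P

    adjacent⇒consecutive : ∀ {i j} → i ≤ len → j ≤ len →
                           Adj G (vertex i) (vertex j) → suc i ≡ j ⊎ suc j ≡ i
    adjacent⇒consecutive {i} {j} i≤ j≤ adj with <-cmp i j
    ... | tri≈ _ refl _ = contradiction adj (irrefl G)
    ... | tri< i<j _ _ with m≤n⇒m<n∨m≡n i<j
    ...   | inj₁ 1+i<j = contradiction adj (chordless 1+i<j j≤)
    ...   | inj₂ 1+i≡j = inj₁ 1+i≡j
    adjacent⇒consecutive i≤ j≤ adj | tri> _ _ j<i with m≤n⇒m<n∨m≡n j<i
    ...   | inj₁ 1+j<i = contradiction (Graph.sym G adj) (chordless 1+j<i i≤)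
    ...   | inj₂ 1+j≡i = inj₂ 1+j≡i

    vertex-injective : ∀ {i j} → i ≤ len → j ≤ len → vertex i ≡ vertex j → i ≡ j
    vertex-injective {i} {j} i≤ j≤ eq with <-cmp i j
    ... | tri≈ _ i≡j _ = i≡j
    ... | tri< i<j _ _ = contradiction eq (distinct i<j j≤)
    ... | tri> _ _ j<i = contradiction (≡.sym eq) (distinct j<i i≤)

    prefix : ∀ {Z : Pred (Fin n) 0ℓ} {i} → i ≤ len → Z (vertex i) →
             (∀ {j} → j < i → ¬ Z (vertex j)) → InducedPath S X Z
    prefix {i = i} i≤ zi below = record
      { len = i ; vertex = vertex
      ; inside = λ k≤ → inside (≤-trans k≤ i≤)
      ; starts = starts ; ends = zi
      ; edge = λ k< → edge (<-≤-trans k< i≤)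
      ; chordless = λ lt k≤ → chordless lt (≤-trans k≤ i≤)
      ; distinct = λ lt k≤ → distinct lt (≤-trans k≤ i≤)
      ; X-only-at-start = λ 0<k k≤ → X-only-at-start 0<k (≤-trans k≤ i≤)
      ; Y-only-at-end = below }

    prefixUntil : ∀ {Z : Pred (Fin n) 0ℓ} → Decidable Z → Z (vertex len) → InducedPath S X Z
    prefixUntil Z? z with least (Z? ∘ vertex) z
    ... | i , i≤ , zi , below = prefix i≤ zi below

  singleton : ∀ {S X u} → S ∋ u → X u → InducedPath S X (_≡ u)
  singleton {u = u} su xu = record
    { len = 0 ; vertex = λ _ → u
    ; inside = λ _ → su
    ; starts = xu ; ends = refl
    ; edge = λ ()
    ; chordless = λ { (s≤s _) () }
    ; distinct = λ { (s≤s _) () }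
    ; X-only-at-start = λ { (s≤s _) () }
    ; Y-only-at-end = λ () }

  module _ {S X v} (P : InducedPath S X (λ w → Adj G w v)) where
    open InducedPath P

    private
      vertex⁺ : ℕ → Fin n
      vertex⁺ k with k ≤? len
      ... | yes _ = vertex k
      ... | no _ = v

      vertex⁺-old : ∀ {k} → k ≤ len → vertex⁺ k ≡ vertex k
      vertex⁺-old {k} k≤len with k ≤? len
      ... | yes _ = refl
      ... | no k≰len = contradiction k≤len k≰len

      vertex⁺-new : vertex⁺ (suc len) ≡ v
      vertex⁺-new with suc len ≤? len
      ... | yes 1+len≤len = contradiction 1+len≤len 1+n≰n
      ... | no _ = refl

    snoc : S ∋ v → ¬ X v → (∀ {j} → j ≤ len → vertex j ≢ v) → InducedPath S X (_≡ v)
    snoc sv ¬xv vertex≢v = record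
      { len = suc len ; vertex = vertex⁺
      ; inside = inside⁺
      ; starts = subst X (≡.sym (vertex⁺-old z≤n)) starts
      ; ends = vertex⁺-new
      ; edge = edge⁺
      ; chordless = chordless⁺
      ; distinct = distinct⁺
      ; X-only-at-start = X-only-at-start⁺
      ; Y-only-at-end = Y-only-at-end⁺ }
      where
      inside⁺ : ∀ {k} → k ≤ suc len → S ∋ vertex⁺ k
      inside⁺ k≤ with ≤-suc-cases k≤
      ... | inj₁ k≤len rewrite vertex⁺-old k≤len = inside k≤len
      ... | inj₂ refl rewrite vertex⁺-new = sv

      edge⁺ : ∀ {k} → k < suc len → Adj G (vertex⁺ k) (vertex⁺ (suc k))
      edge⁺ k< with m≤n⇒m<n∨m≡n (≤-pred k<)
      ... | inj₁ k<len rewrite vertex⁺-old (<⇒≤ k<len) | vertex⁺-old k<len = edge k<len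
      ... | inj₂ refl rewrite vertex⁺-old (≤-refl {len}) | vertex⁺-new = ends

      chordless⁺ : ∀ {i j} → suc i < j → j ≤ suc len → ¬ Adj G (vertex⁺ i) (vertex⁺ j)
      chordless⁺ 1+i<j j≤ with ≤-suc-cases j≤
      ... | inj₁ j≤len rewrite vertex⁺-old (<⇒≤ (<-trans (n<1+n _) (<-≤-trans 1+i<j j≤len)))
                             | vertex⁺-old j≤len = chordless 1+i<j j≤len
      ... | inj₂ refl rewrite vertex⁺-old (≤-pred (<⇒≤ 1+i<j)) | vertex⁺-new =
        Y-only-at-end (≤-pred 1+i<j)

      distinct⁺ : ∀ {i j} → i < j → j ≤ suc len → vertex⁺ i ≢ vertex⁺ j
      distinct⁺ i<j j≤ with ≤-suc-cases j≤
      ... | inj₁ j≤len rewrite vertex⁺-old (<⇒≤ (<-≤-trans i<j j≤len)) | vertex⁺-old j≤len =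
        distinct i<j j≤len
      ... | inj₂ refl rewrite vertex⁺-old (≤-pred i<j) | vertex⁺-new = vertex≢v (≤-pred i<j)

      X-only-at-start⁺ : ∀ {k} → 0 < k → k ≤ suc len → ¬ X (vertex⁺ k)
      X-only-at-start⁺ 0<k k≤ with ≤-suc-cases k≤
      ... | inj₁ k≤len rewrite vertex⁺-old k≤len = X-only-at-start 0<k k≤len
      ... | inj₂ refl rewrite vertex⁺-new = ¬xv

      Y-only-at-end⁺ : ∀ {k} → k < suc len → vertex⁺ k ≢ v
      Y-only-at-end⁺ k< rewrite vertex⁺-old (≤-pred k<) = vertex≢v (≤-pred k<)

  module _ {S : VSet n} {X : Pred (Fin n) 0ℓ} (X? : Decidable X) where

    -- v is attached to the first vertex of the path that equals or is adjacent to v; no earlier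
    -- vertex does, so the path stays induced.
    extend : ∀ {u v} → InducedPath S X (_≡ u) → S ∋ v → Adj G u v → InducedPath S X (_≡ v)
    extend {v = v} P sv uv with X? v
    ... | yes xv = singleton sv xv
    ... | no ¬xv with least (λ i → (vertex i Fin.≟ v) ⊎-dec adj? G (vertex i) v)
                            (inj₂ (subst (λ w → Adj G w v) (≡.sym ends) uv))
      where open InducedPath P
    ... | i , i≤ , inj₁ vi≡v , below = prefix P i≤ vi≡v (λ j<i → below j<i ∘ inj₁)
    ... | i , i≤ , inj₂ vi~v , below =
      snoc (prefix P i≤ vi~v (λ j<i → below j<i ∘ inj₂)) sv ¬xv vertex≢v
      where
      open InducedPath P
      vertex≢v : ∀ {j} → j ≤ i → vertex j ≢ v
      vertex≢v j≤i vj≡v with m≤n⇒m<n∨m≡n j≤i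
      ... | inj₁ j<i = below j<i (inj₁ vj≡v)
      ... | inj₂ refl = irrefl G (subst (λ w → Adj G w v) vj≡v vi~v)

    extendAlong : ∀ {u v} → InducedPath S X (_≡ u) → WalkIn G S u v → InducedPath S X (_≡ v)
    extendAlong P (here _) = P
    extendAlong P (step _ uw walk) = extendAlong (extend P (walk-start walk) uw) walk

  inducedPath : ∀ {S : VSet n} {X Y : Pred (Fin n) 0ℓ} {u v} → Decidable X → Decidable Y →
                X u → Y v → WalkIn G S u v → InducedPath S X Y
  inducedPath {S} {X} {Y} {v = v} X? Y? xu yv walk =
    prefixUntil P Y? (subst Y (≡.sym (InducedPath.ends P)) yv)
    where
    P : InducedPath S X (_≡ v)
    P = extendAlong X? (singleton (walk-start walk) xu) walk

  module Closing {S T : VSet n} {X Y X′ Y′ : Pred (Fin n) 0ℓ}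
    (P : InducedPath S X Y) (Q : InducedPath T X′ Y′)
    (disjoint : ∀ {i t} → i ≤ InducedPath.len P → t ≤ InducedPath.len Q →
                InducedPath.vertex P i ≢ InducedPath.vertex Q t)
    (cross : ∀ {i t} → i ≤ InducedPath.len P → t ≤ InducedPath.len Q →
             Adj G (InducedPath.vertex P i) (InducedPath.vertex Q t) →
             i ≡ InducedPath.len P × t ≡ 0 ⊎ i ≡ 0 × t ≡ InducedPath.len Q)
    (join : Adj G (InducedPath.vertex P (InducedPath.len P)) (InducedPath.vertex Q 0))
    (close : Adj G (InducedPath.vertex Q (InducedPath.len Q)) (InducedPath.vertex P 0))
    where
    private
      module P = InducedPath P
      module Q = InducedPath Q
      r = P.len
      s = Q.len

    k : ℕ
    k = suc r + suc s

    around : ℕ → Fin n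
    around i with i ≤? r
    ... | yes _ = P.vertex i
    ... | no _ = Q.vertex (i ∸ suc r)

    around-P : ∀ {i} → i ≤ r → around i ≡ P.vertex i
    around-P {i} i≤r with i ≤? r
    ... | yes _ = refl
    ... | no i≰r = contradiction i≤r i≰r

    around-Q : ∀ t → around (suc r + t) ≡ Q.vertex t
    around-Q t with suc r + t ≤? r
    ... | yes ≤r = contradiction ≤r (<⇒≱ (s≤s (m≤m+n r t)))
    ... | no _ = cong Q.vertex (m+n∸m≡n (suc r) t)

    data Position : ℕ → Set where
      onP : ∀ {i} → i ≤ r → Position i
      onQ : ∀ {t} → t ≤ s → Position (suc r + t)

    position : ∀ {i} → i < k → Position i
    position {i} i<k with i ≤? r
    ... | yes i≤r = onP i≤r
    ... | no i≰r = subst Position (m+[n∸m]≡n (≰⇒> i≰r))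
                     (onQ (≤-pred (m<n+o⇒m∸n<o i (suc r) i<k)))

    around-injective : ∀ {i j} → i < k → j < k → around i ≡ around j → i ≡ j
    around-injective i<k j<k eq with position i<k | position j<k
    ... | onP i≤ | onP j≤ = vertex-injective P i≤ j≤
                              (≡.trans (≡.sym (around-P i≤)) (≡.trans eq (around-P j≤)))
    ... | onP i≤ | onQ {t} t≤ = contradiction
                              (≡.trans (≡.sym (around-P i≤)) (≡.trans eq (around-Q t)))
                              (disjoint i≤ t≤)
    ... | onQ {t} t≤ | onP j≤ = contradiction
                              (≡.trans (≡.sym (around-P j≤)) (≡.trans (≡.sym eq) (around-Q t)))
                              (disjoint j≤ t≤)
    ... | onQ {t} t≤ | onQ {u} u≤ = cong (suc r +_) (vertex-injective Q t≤ u≤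
                              (≡.trans (≡.sym (around-Q t)) (≡.trans eq (around-Q u))))

    cross-cyclic : ∀ {i t} → i ≡ r × t ≡ 0 ⊎ i ≡ 0 × t ≡ s → CycAdjℕ k i (suc r + t)
    cross-cyclic (inj₁ (refl , refl)) = inj₁ (inj₁ (cong suc (≡.sym (+-identityʳ r))))
    cross-cyclic (inj₂ (refl , refl)) = inj₂ (inj₂ (≡.sym (+-suc (suc r) s) , refl))

    adjacent⇒cyclic : ∀ {i j} → i < k → j < k → Adj G (around i) (around j) → CycAdjℕ k i j
    adjacent⇒cyclic i<k j<k adj with position i<k | position j<k
    ... | onP i≤ | onP j≤ rewrite around-P i≤ | around-P j≤ =
      Sum.map inj₁ inj₁ (adjacent⇒consecutive P i≤ j≤ adj)
    ... | onP i≤ | onQ {t} t≤ rewrite around-P i≤ | around-Q t =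
      cross-cyclic (cross i≤ t≤ adj)
    ... | onQ {t} t≤ | onP j≤ rewrite around-P j≤ | around-Q t =
      Sum.swap (cross-cyclic (cross j≤ t≤ (Graph.sym G adj)))
    ... | onQ {t} t≤ | onQ {u} u≤ rewrite around-Q t | around-Q u =
      Sum.map (inj₁ ∘ shift t) (inj₁ ∘ shift u) (adjacent⇒consecutive Q t≤ u≤ adj)
      where
      shift : ∀ t {u} → suc t ≡ u → suc (suc r + t) ≡ suc r + u
      shift t refl = ≡.sym (+-suc (suc r) t)

    next⇒adjacent : ∀ {i j} → i < k → j < k → Nextℕ k i j → Adj G (around i) (around j)
    next⇒adjacent i<k _ (inj₁ refl) with position i<k
    ... | onP i≤ with m≤n⇒m<n∨m≡n i≤
    ...   | inj₁ i<r rewrite around-P i≤ | around-P i<r = P.edge i<r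
    ...   | inj₂ refl = subst₂ (Adj G) (≡.sym (around-P i≤)) (≡.sym around-suc-r) join
      where
      around-suc-r : around (suc r) ≡ Q.vertex 0
      around-suc-r = ≡.trans (cong around (≡.sym (+-identityʳ (suc r)))) (around-Q 0)
    next⇒adjacent _ j<k (inj₁ refl) | onQ {t} t≤ =
      subst₂ (Adj G) (≡.sym (around-Q t)) (≡.sym around-next)
        (Q.edge (≤-pred (+-cancelˡ-< (suc r) (suc t) (suc s) (subst (_< k) shift j<k))))
      where
      shift : suc (suc r + t) ≡ suc r + suc t
      shift = ≡.sym (+-suc (suc r) t)
      around-next : around (suc (suc r + t)) ≡ Q.vertex (suc t)
      around-next = ≡.trans (cong around shift) (around-Q (suc t))
    next⇒adjacent _ _ (inj₂ (1+i≡k , refl))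
      rewrite suc-injective (≡.trans 1+i≡k (+-suc (suc r) s)) | around-Q s | around-P z≤n = close

    cyclic⇒adjacent : ∀ {i j} → i < k → j < k → CycAdjℕ k i j → Adj G (around i) (around j)
    cyclic⇒adjacent i<k j<k (inj₁ next) = next⇒adjacent i<k j<k next
    cyclic⇒adjacent i<k j<k (inj₂ prev) = Graph.sym G (next⇒adjacent j<k i<k prev)

    inducedCycle : 3 ≤ k → InducedCycle G k (around ∘ toℕ)
    inducedCycle 3≤k = record
      { length≥3 = 3≤k
      ; distinct = λ {a} {b} → Fin.toℕ-injective ∘ around-injective (Fin.toℕ<n a) (Fin.toℕ<n b)
      ; adj⇔ = λ a b → mk⇔ (adjacent⇒cyclic (Fin.toℕ<n a) (Fin.toℕ<n b))
                           (cyclic⇒adjacent (Fin.toℕ<n a) (Fin.toℕ<n b)) }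

module CyclicSequence {n : ℕ} (G : Graph n) {m : ℕ} (A : Fin (3 + m) → VSet n)
                      (cs : InducedCyclicSeq G (3 + m) A) where
  open InducedCyclicSeq cs
  open Paths G

  one last : Fin (3 + m)
  one = fsuc fzero
  last = fromℕ< (n<1+n (2 + m))

  toℕ-last : toℕ last ≡ 2 + m
  toℕ-last = Fin.toℕ-fromℕ< (n<1+n (2 + m))

  Rest : VSet n
  Rest = record
    { _∋_ = λ v → ∃ λ j → j ≢ fzero × A j ∋ v
    ; mem? = λ v → Fin.any? (λ j → ¬? (j Fin.≟ fzero) ×-dec mem? (A j) v) }

  TouchesA₀ : Pred (Fin n) 0ℓ
  TouchesA₀ v = ∃ λ a → A fzero ∋ a × Adj G v a

  touchesA₀? : Decidable TouchesA₀
  touchesA₀? v = Fin.any? (λ a → mem? (A fzero) a ×-dec adj? G v a)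

  Start End : Pred (Fin n) 0ℓ
  Start v = A one ∋ v × TouchesA₀ v
  End v = A last ∋ v × TouchesA₀ v

  Rest-index≢0 : ∀ {j v} → Rest ∋ v → A j ∋ v → j ≢ fzero
  Rest-index≢0 (j , j≢0 , v∈Aj) v∈A₀ refl = disjoint j fzero j≢0 _ v∈Aj v∈A₀

  adjacent-index≤suc : ∀ {i j u w} → i ≢ fzero → j ≢ fzero → A i ∋ u → A j ∋ w → Adj G u w →
                       toℕ j ≤ suc (toℕ i)
  adjacent-index≤suc {i} {j} i≢0 j≢0 u∈Ai w∈Aj uw with toℕ j ≤? suc (toℕ i)
  ... | yes j≤1+i = j≤1+i
  ... | no j≰1+i = contradiction (_ , _ , u∈Ai , w∈Aj , uw) (nonconsec i j i≢j ¬cyclic)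
    where
    2+i≤j : suc (suc (toℕ i)) ≤ toℕ j
    2+i≤j = ≰⇒> j≰1+i
    i≢j : i ≢ j
    i≢j refl = j≰1+i (n≤1+n _)
    ¬cyclic : ¬ CycAdj (3 + m) i j
    ¬cyclic (inj₁ (inj₁ 1+i≡j)) = 1+n≰n (subst (suc (suc (toℕ i)) ≤_) (≡.sym 1+i≡j) 2+i≤j)
    ¬cyclic (inj₁ (inj₂ (_ , j≡0))) = j≢0 (Fin.toℕ-injective j≡0)
    ¬cyclic (inj₂ (inj₁ 1+j≡i)) =
      <-asym (≤-trans (n≤1+n _) 2+i≤j) (subst (suc (toℕ j) ≤_) 1+j≡i ≤-refl)
    ¬cyclic (inj₂ (inj₂ (_ , i≡0))) = i≢0 (Fin.toℕ-injective i≡0)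

  start? : Decidable Start
  start? v = mem? (A one) v ×-dec touchesA₀? v

  end? : Decidable End
  end? v = mem? (A last) v ×-dec touchesA₀? v

  walk-within : ∀ j → j ≢ fzero → ∀ {u v} → A j ∋ u → A j ∋ v → WalkIn G Rest u v
  walk-within j j≢0 u∈ v∈ = walk-mono (λ w∈ → j , j≢0 , w∈) (proj₂ (connected j) _ _ u∈ v∈)

  walk-from-A₁ : ∀ {x} → A one ∋ x → ∀ t (t<m : suc t < 3 + m) {v} → A (fromℕ< t<m) ∋ v →
                 WalkIn G Rest x v
  walk-from-A₁ x∈A₁ zero _ v∈A₁ = walk-within one (λ ()) x∈A₁ v∈A₁
  walk-from-A₁ x∈A₁ (suc t) t+2<m v∈ =
    let a , b , a∈ , b∈ , ab = consecutive (fromℕ< t+1<m) (fromℕ< t+2<m) (inj₁ successor)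
    in walk-from-A₁ x∈A₁ t t+1<m a∈ ++ʷ step (_ , (λ ()) , a∈) ab (walk-within _ (λ ()) b∈ v∈)
    where
    t+1<m : suc t < 3 + m
    t+1<m = <-trans (n<1+n (suc t)) t+2<m
    successor : suc (toℕ (fromℕ< t+1<m)) ≡ toℕ (fromℕ< t+2<m)
    successor = ≡.trans (cong suc (Fin.toℕ-fromℕ< t+1<m)) (≡.sym (Fin.toℕ-fromℕ< t+2<m))

  walk-through-Rest : ∃ λ x → ∃ λ y → Start x × End y × WalkIn G Rest x y
  walk-through-Rest with consecutive fzero one (inj₁ refl)
                       | consecutive last fzero (inj₂ (cong suc toℕ-last , refl))
  ... | a , x , a∈A₀ , x∈A₁ , ax | y , b , y∈Aℓ , b∈A₀ , yb =
    x , y , (x∈A₁ , a , a∈A₀ , Graph.sym G ax) , (y∈Aℓ , b , b∈A₀ , yb) ,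
    walk-from-A₁ x∈A₁ (suc m) (n<1+n (2 + m)) y∈Aℓ

  abstract
    P : InducedPath Rest Start End
    P with walk-through-Rest
    ... | _ , _ , x-start , y-end , walk = inducedPath start? end? x-start y-end walk

  module P = InducedPath P

  r : ℕ
  r = P.len

  p : ℕ → Fin n
  p = P.vertex

  P-index≤suc : ∀ {i j} → i ≤ r → A j ∋ p i → toℕ j ≤ suc i
  P-index≤suc {zero} {j} _ p₀∈Aj with j Fin.≟ one
  ... | yes refl = ≤-refl
  ... | no j≢1 = contradiction (proj₁ P.starts) (disjoint j one j≢1 _ p₀∈Aj)
  P-index≤suc {suc i} {j} i+1≤r pᵢ₊₁∈Aj with P.inside (≤-trans (n≤1+n i) i+1≤r)
  ... | j′ , j′≢0 , pᵢ∈Aj′ = ≤-trans step-bound (s≤s (P-index≤suc (≤-trans (n≤1+n i) i+1≤r) pᵢ∈Aj′))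
    where
    step-bound : toℕ j ≤ suc (toℕ j′)
    step-bound = adjacent-index≤suc j′≢0 (Rest-index≢0 (P.inside i+1≤r) pᵢ₊₁∈Aj)
                                    pᵢ∈Aj′ pᵢ₊₁∈Aj (P.edge i+1≤r)

  P-long : 3 + m ≤ suc (suc r)
  P-long = s≤s (subst (_≤ suc r) toℕ-last (P-index≤suc ≤-refl (proj₁ P.ends)))

  interior-avoids-A₀ : ∀ {i} → 0 < i → i < r → ¬ TouchesA₀ (p i)
  interior-avoids-A₀ {i} 0<i i<r touch with P.inside (<⇒≤ i<r)
  ... | j , j≢0 , pᵢ∈Aj with j Fin.≟ one | j Fin.≟ last
  ... | yes refl | _ = P.X-only-at-start 0<i (<⇒≤ i<r) (pᵢ∈Aj , touch)
  ... | no _ | yes refl = P.Y-only-at-end i<r (pᵢ∈Aj , touch)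
  ... | no j≢1 | no j≢ℓ =
    nonconsec j fzero j≢0 ¬cyclic (p i , proj₁ touch , pᵢ∈Aj , proj₂ touch)
    where
    ¬cyclic : ¬ CycAdj (3 + m) j fzero
    ¬cyclic (inj₁ (inj₂ (1+j≡3+m , _))) =
      j≢ℓ (Fin.toℕ-injective (≡.trans (suc-injective 1+j≡3+m) (≡.sym toℕ-last)))
    ¬cyclic (inj₂ (inj₁ 1≡j)) = j≢1 (Fin.toℕ-injective (≡.sym 1≡j))

  abstract
    Q : InducedPath (A fzero) (Adj G (p r)) (Adj G (p 0))
    Q =
      let a , a∈A₀ , pᵣa = proj₂ P.ends
          b , b∈A₀ , p₀b = proj₂ P.starts
      in inducedPath (adj? G (p r)) (adj? G (p 0)) pᵣa p₀b
                     (proj₂ (connected fzero) a b a∈A₀ b∈A₀)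

  module Q = InducedPath Q

  P-Q-disjoint : ∀ {i t} → i ≤ r → t ≤ Q.len → p i ≢ Q.vertex t
  P-Q-disjoint i≤r t≤s pᵢ≡qₜ =
    Rest-index≢0 (P.inside i≤r) (subst (A fzero ∋_) (≡.sym pᵢ≡qₜ) (Q.inside t≤s)) refl

  P-Q-edges : ∀ {i t} → i ≤ r → t ≤ Q.len → Adj G (p i) (Q.vertex t) →
              i ≡ r × t ≡ 0 ⊎ i ≡ 0 × t ≡ Q.len
  P-Q-edges {i} {t} i≤r t≤s adj with i ≟ r | i ≟ 0 | t ≟ 0 | t ≟ Q.len
  ... | yes i≡r | _ | yes t≡0 | _ = inj₁ (i≡r , t≡0)
  ... | yes refl | _ | no t≢0 | _ = contradiction adj (Q.X-only-at-start (n≢0⇒n>0 t≢0) t≤s)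
  ... | no _ | yes i≡0 | _ | yes t≡s = inj₂ (i≡0 , t≡s)
  ... | no _ | yes refl | _ | no t≢s = contradiction adj (Q.Y-only-at-end (≤∧≢⇒< t≤s t≢s))
  ... | no i≢r | no i≢0 | _ | _ =
    contradiction (Q.vertex t , Q.inside t≤s , adj)
                  (interior-avoids-A₀ (n≢0⇒n>0 i≢0) (≤∧≢⇒< i≤r i≢r))

lemma4p7 : ∀ {n : ℕ} (G : Graph n) (m : ℕ) (A : Fin m → VSet n) →
    3 ≤ m → InducedCyclicSeq G m A →
    Σ ℕ (λ k → m ≤ k × Σ (Fin k → Fin n) (λ v → InducedCycle G k v))
lemma4p7 G _ A (s≤s (s≤s (s≤s {n = m} _))) cs =
  k , m≤k , around ∘ toℕ , inducedCycle (≤-trans (s≤s (s≤s (s≤s z≤n))) m≤k)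
  where
  open CyclicSequence G A cs
  open Paths.Closing G P Q P-Q-disjoint P-Q-edges Q.starts (Graph.sym G Q.ends)
  m≤k : 3 + m ≤ k
  m≤k = ≤-trans P-long (s≤s (m<m+n r z<s))
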